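{- Let $m(i,j)$ and $a(j,k)$ be the integer matrices defined below. Then for all integers $j\ge1$ and $k\ge1$, \begin{align*} \nu_3(a(2j-1,k)) &\ge 2j-1+\delta_{k,1}+\left\lfloor\frac{9k-10}{2}\right\rfloor,\\ \nu_3(a(2j,k)) &\ge 2j+1+\delta_{k,1}+\left\lfloor\frac{9k-10}{2}\right\rfloor, \end{align*} where $\delta_{k,1}$ is $1$ if $k=1$ and $0$ otherwise.
   Context: $\nu_3(n)$ denotes the exponent of the highest power of $3$ dividing $n$, with $\nu_3(0)=\infty$. The matrix $\{m(i,j)\}_{i,j\ge1}$ is defined by (with $m(i,j)=0$ for $i\le0$): $m(1,1)=9$, $m(2,1)=6$, $m(3,1)=1$, $m(i,1)=0$ for $i\ge4$, and for $j\ge2$, $m(i,j)=27m(i-1,j-1)+9m(i-2,j-1)+m(i-3,j-1)$. The matrix $\{a(j,k)\}_{j,k\ge1}$ is defined by $a(1,1)=6$, $a(1,2)=243$, $a(1,k)=0$ for $k\ge3$, and for $j,k\ge1$: $a(j+1,k)=\sum_{i\ge1}a(j,i)m(4i,i+k)$ if $j$ is odd, and $a(j+1,k)=\sum_{i\ge1}a(j,i)m(4i+2,i+k)$ if $j$ is even (these sums are finite since $m(i,j)=0$ unless $\lfloor(i+2)/3\rfloor\le j\le i$). -}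

module Defs where

open import Data.Nat using (ℕ; zero; suc; _+_; _*_; _∸_; _^_; _≡ᵇ_)
open import Data.Nat.Divisibility using (_∣_)
open import Data.Bool using (if_then_else_)
open import Data.Nat.DivMod using (_%_)
open import Data.Integer as ℤ using (ℤ; +_)
open import Data.Integer.DivMod using (_/ℕ_)

sum1 : (ℕ → ℕ) → ℕ → ℕ
sum1 f zero    = 0
sum1 f (suc n) = sum1 f n + f (suc n)

-- m(i,j) for i,j ≥ 1; m(i,j) = 0 for i ≤ 0 (m(i,0) := 0 is never used)
m : ℕ → ℕ → ℕ
m zero _ = 0
m (suc i) zero = 0
m 1 1 = 9
m 2 1 = 6
m 3 1 = 1
m (suc i) 1 = 0
m (suc i) (suc (suc j)) =
  27 * m i (suc j) + 9 * m (i ∸ 1) (suc j) + m (i ∸ 2) (suc j)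

-- a(j,k) for j,k ≥ 1 (a(0,k) := 0 is never used).
-- a(j+1,k) = Σ_{i≥1} a(j,i) m(4i+c, i+k), c = 0 if j odd, c = 2 if j even.
-- The sum is truncated at i = 3k: m(4i+c, i+k) = 0 unless ⌊(4i+c+2)/3⌋ ≤ i+k,
-- which forces i ≤ 3k, so all omitted terms vanish.
a : ℕ → ℕ → ℕ
a zero k = 0
a 1 1 = 6
a 1 2 = 243
a 1 k = 0
a (suc (suc j)) k =
  sum1 (λ i → a (suc j) i * m (4 * i + c) (i + k)) (3 * k)
  where
  c : ℕ
  c = if (suc j % 2) ≡ᵇ 1 then 0 else 2

δ1 : ℕ → ℕ
δ1 k = if k ≡ᵇ 1 then 1 else 0

-- ν₃(n) ≥ b  (b an integer), with ν₃(0) = ∞:  3^e ∣ n for every natural e ≤ b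
ν3≥ : ℕ → ℤ → Set
ν3≥ n b = ∀ (e : ℕ) → + e ℤ.≤ b → 3 ^ e ∣ n

fl : ℕ → ℤ
fl k = (+ (9 * k) ℤ.- + 10) /ℕ 2

module Submission where

-- Every bound below has the form ν₃(x) ≥ ⌊(v − u)/2⌋.  Along its recurrence
-- ν₃(m(i,j)) ≥ ⌊(9j − 3i − 1)/2⌋, and if ν₃(a(n,i)) ≥ ⌊(2B + 9i + 2δ_{i,1} − 10)/2⌋
-- for all i, then each summand a(n,i) m(4i+c, i+k) of a(n+1,k) obeys the same bound
-- with B replaced by B + 2 (c = 0, n odd) or by B (c = 2, n even).  A product costs
-- one unit, as ⌊x/2⌋ + ⌊y/2⌋ ≥ ⌊(x + y − 1)/2⌋, and what is left is the margin
-- 6i + 2δ_{i,1} − 3c − 2 ≥ 2δ_{k,1} + 2(B′ − B); it fails only for c = 2 and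
-- i = k = 1, where the bound on a(n,1) alone suffices.

open import Defs
open import Data.Nat using (ℕ; zero; suc; _+_; _*_; _∸_; _^_; _≤_; z≤n; _≤?_; _≡ᵇ_)
open import Data.Nat.DivMod using (_%_; [m+kn]%n≡m%n)
open import Data.Bool using (if_then_else_)
open import Data.Nat.Properties
open import Data.Nat.Divisibility using (_∣_; divides; _∣0; 1∣_; ∣m⇒∣m*n; ∣m∣n⇒∣m+n; *-pres-∣)
open import Data.Integer as ℤ using (+_)
import Data.Integer.Properties as ℤ
open import Data.Integer.DivMod using (_/ℕ_; [n/ℕd]*d≤n)
import Data.Integer.Tactic.RingSolver as ℤ-Solver
open import Data.Nat.Tactic.RingSolver using (solve-∀)
open import Data.Product using (∃₂; _×_; _,_; proj₁; proj₂)
open import Data.Sum using (_⊎_; inj₁; inj₂)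
open import Data.Empty using (⊥-elim)
open import Relation.Nullary using (yes; no)
open import Relation.Binary.PropositionalEquality using (_≡_; refl; sym; trans; cong; subst; subst₂)

^-monoʳ-∣ : ∀ b {x s} → x ≤ s → b ^ x ∣ b ^ s
^-monoʳ-∣ b {x} x≤s with m≤n⇒∃[o]m+o≡n x≤s
... | d , refl = divides (b ^ d) (trans (^-distribˡ-+-* b x d) (*-comm (b ^ x) (b ^ d)))

-- ν₃(n) ≥ ⌊(v − u)/2⌋, with the bound kept as a pair of naturals so that no
-- integer arithmetic is needed.
ν3≥half : ℕ → ℕ → ℕ → Set
ν3≥half n v u = ∀ x → 2 * x + u ≤ v → 3 ^ x ∣ n

ν3≥half-0 : ∀ {v u} → ν3≥half 0 v u
ν3≥half-0 x _ = (3 ^ x) ∣0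

ν3≥half-weaken : ∀ {n v u v′ u′} → v′ + u ≤ v + u′ → ν3≥half n v u → ν3≥half n v′ u′
ν3≥half-weaken {v = v} {u} {v′} {u′} v′u≤vu′ h x le = h x (+-cancelʳ-≤ u′ _ _ (begin
  2 * x + u + u′ ≡⟨ swap (2 * x) u u′ ⟩
  2 * x + u′ + u ≤⟨ +-monoˡ-≤ u le ⟩
  v′ + u         ≤⟨ v′u≤vu′ ⟩
  v + u′         ∎))
  where
  open ≤-Reasoning
  swap : ∀ a b c → a + b + c ≡ a + c + b
  swap = solve-∀

ν3≥half-+ : ∀ {p q v u} → ν3≥half p v u → ν3≥half q v u → ν3≥half (p + q) v u
ν3≥half-+ hp hq x le = ∣m∣n⇒∣m+n (hp x le) (hq x le)

ν3≥half-sum1 : ∀ {f v u} → (∀ i → ν3≥half (f (suc i)) v u) → ∀ N → ν3≥half (sum1 f N) v u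
ν3≥half-sum1 h zero    = ν3≥half-0
ν3≥half-sum1 h (suc N) = ν3≥half-+ (ν3≥half-sum1 h N) (h N)

ν3≥half-*ʳ : ∀ {p v u} q → ν3≥half p v u → ν3≥half (p * q) v u
ν3≥half-*ʳ q h x le = ∣m⇒∣m*n q (h x le)

ν3≥half-3^ : ∀ s → ν3≥half (3 ^ s) (2 * s + 1) 0
ν3≥half-3^ s x le = ^-monoʳ-∣ 3 (m<1+n⇒m≤n (*-cancelˡ-< 2 x (suc s) (begin-strict
  2 * x           ≡⟨ +-identityʳ (2 * x) ⟨
  2 * x + 0       ≤⟨ le ⟩
  2 * s + 1       <⟨ n<1+n (2 * s + 1) ⟩
  suc (2 * s + 1) ≡⟨ double-suc s ⟩
  2 * suc s       ∎)))
  where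
  open ≤-Reasoning
  double-suc : ∀ s → suc (2 * s + 1) ≡ 2 * suc s
  double-suc = solve-∀

exponent-split : ∀ {v₁ u₁ v₂ u₂} N → 2 * N + (u₁ + u₂ + 1) ≤ v₁ + v₂ →
  ∃₂ λ x y → N ≡ x + y × (x ≡ 0 ⊎ 2 * x + u₁ ≤ v₁) × (y ≡ 0 ⊎ 2 * y + u₂ ≤ v₂)
exponent-split zero _ = 0 , 0 , refl , inj₁ refl , inj₁ refl
exponent-split {v₁} {u₁} {v₂} {u₂} (suc N) h
  with exponent-split {v₁} {u₁} {v₂} {u₂} N
         (≤-trans (+-monoˡ-≤ (u₁ + u₂ + 1) (*-monoʳ-≤ 2 (n≤1+n N))) h)
... | x , y , refl , fx , fy with 2 * suc x + u₁ ≤? v₁ | 2 * suc y + u₂ ≤? v₂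
...   | yes p | _     = suc x , y , refl , inj₂ p , fy
...   | no _  | yes q = x , suc y , sym (+-suc x y) , fx , inj₂ q
...   | no p  | no q  = ⊥-elim (n≮n P (begin-strict
  P                                       <⟨ n<1+n P ⟩
  suc P                                   ≡⟨ regroup x y u₁ u₂ ⟩
  2 * suc (x + y) + (u₁ + u₂ + 1) + 2     ≤⟨ +-monoˡ-≤ 2 h ⟩
  v₁ + v₂ + 2                             ≡⟨ +-suc-suc v₁ v₂ ⟩
  suc v₁ + suc v₂                         ≤⟨ +-mono-≤ (≰⇒> p) (≰⇒> q) ⟩
  P                                       ∎))
  where
  open ≤-Reasoning
  P = (2 * suc x + u₁) + (2 * suc y + u₂)
  regroup : ∀ x y u₁ u₂ → suc ((2 * suc x + u₁) + (2 * suc y + u₂))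
                          ≡ 2 * suc (x + y) + (u₁ + u₂ + 1) + 2
  regroup = solve-∀
  +-suc-suc : ∀ m n → m + n + 2 ≡ suc m + suc n
  +-suc-suc = solve-∀

ν3≥half-* : ∀ {p q v₁ u₁ v₂ u₂} → ν3≥half p v₁ u₁ → ν3≥half q v₂ u₂ →
            ν3≥half (p * q) (v₁ + v₂) (u₁ + u₂ + 1)
ν3≥half-* {p} {q} {v₁} {u₁} {v₂} {u₂} hp hq N le with exponent-split {v₁} {u₁} {v₂} {u₂} N le
... | x , y , refl , fx , fy =
  subst (_∣ p * q) (sym (^-distribˡ-+-* 3 x y)) (*-pres-∣ (at hp fx) (at hq fy))
  where
  at : ∀ {n v u z} → ν3≥half n v u → z ≡ 0 ⊎ 2 * z + u ≤ v → 3 ^ z ∣ n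
  at {n} _ (inj₁ refl) = 1∣ n
  at {z = z} h (inj₂ le) = h z le

ν3≥half-3^* : ∀ {n v u} s → ν3≥half n v u → ν3≥half (3 ^ s * n) (2 * s + v) u
ν3≥half-3^* {v = v} {u} s h =
  ν3≥half-weaken (≤-reflexive (shift s v u)) (ν3≥half-* (ν3≥half-3^ s) h)
  where
  shift : ∀ s v u → 2 * s + v + (0 + u + 1) ≡ 2 * s + 1 + v + u
  shift = solve-∀

m-step : ∀ i j →
  m (suc i) (suc (suc j)) ≡ 27 * m i (suc j) + 9 * m (i ∸ 1) (suc j) + m (i ∸ 2) (suc j)
m-step zero                j = refl
m-step (suc zero)          j = refl
m-step (suc (suc zero))    j = refl
m-step (suc (suc (suc i))) j = refl

ν3≥half-m : ∀ i j → ν3≥half (m i j) (9 * j) (3 * i + 1)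
ν3≥half-m zero                      j    = ν3≥half-0
ν3≥half-m (suc i)                   zero = ν3≥half-0
ν3≥half-m 1                         1    = ν3≥half-weaken ≤-refl (ν3≥half-3^ 2)
ν3≥half-m 2                         1    = ν3≥half-weaken (n≤1+n 9) (ν3≥half-*ʳ 2 (ν3≥half-3^ 1))
ν3≥half-m 3                         1    = ν3≥half-weaken (m≤m+n 9 2) (ν3≥half-3^ 0)
ν3≥half-m (suc (suc (suc (suc i)))) 1    = ν3≥half-0
ν3≥half-m (suc i) (suc (suc j)) rewrite m-step i j =
  ν3≥half-+ (ν3≥half-+ by27 (by9 i)) (by1 i)
  where
  V = 9 * suc (suc j)
  by27 : ν3≥half (27 * m i (suc j)) V (3 * suc i + 1)
  by27 = ν3≥half-weaken (≤-reflexive (e i j)) (ν3≥half-3^* 3 (ν3≥half-m i (suc j)))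
    where
    e : ∀ i j → 9 * (2 + j) + (3 * i + 1) ≡ 2 * 3 + 9 * suc j + (3 * suc i + 1)
    e = solve-∀
  by9 : ∀ i → ν3≥half (9 * m (i ∸ 1) (suc j)) V (3 * suc i + 1)
  by9 zero    = ν3≥half-0
  by9 (suc i) =
    ν3≥half-weaken (≤-trans (n≤1+n _) (≤-reflexive (e i j))) (ν3≥half-3^* 2 (ν3≥half-m i (suc j)))
    where
    e : ∀ i j → suc (9 * (2 + j) + (3 * i + 1)) ≡ 2 * 2 + 9 * suc j + (3 * (2 + i) + 1)
    e = solve-∀
  by1 : ∀ i → ν3≥half (m (i ∸ 2) (suc j)) V (3 * suc i + 1)
  by1 zero          = ν3≥half-0
  by1 (suc zero)    = ν3≥half-0
  by1 (suc (suc i)) = ν3≥half-weaken (≤-reflexive (e i j)) (ν3≥half-m i (suc j))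
    where
    e : ∀ i j → 9 * (2 + j) + (3 * i + 1) ≡ 9 * suc j + (3 * (3 + i) + 1)
    e = solve-∀

δ1≤1 : ∀ k → δ1 k ≤ 1
δ1≤1 zero          = z≤n
δ1≤1 (suc zero)    = ≤-refl
δ1≤1 (suc (suc k)) = z≤n

record ABound (n B : ℕ) : Set where
  constructor aBound
  field bound : ∀ k → ν3≥half (a n k) (2 * B + 9 * k + 2 * δ1 k) 10

ABound-1 : ABound 1 1
ABound-1 = aBound λ where
  zero                → ν3≥half-0
  1                   → ν3≥half-weaken ≤-refl (ν3≥half-*ʳ 2 (ν3≥half-3^ 1))
  2                   → ν3≥half-weaken (n≤1+n 20) (ν3≥half-3^ 5)
  (suc (suc (suc k))) → ν3≥half-0

ν3≥half-summand : ∀ {p B} c inc i k → 3 * c + 2 * inc + 2 + 2 * δ1 k ≤ 6 * i + 2 * δ1 i →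
  ν3≥half p (2 * B + 9 * i + 2 * δ1 i) 10 →
  ν3≥half (p * m (4 * i + c) (i + k)) (2 * (inc + B) + 9 * k + 2 * δ1 k) 10
ν3≥half-summand {B = B} c inc i k slack h =
  ν3≥half-weaken (subst₂ _≤_ (left c inc i k B (δ1 k)) (right i k B (δ1 i)) (+-monoˡ-≤ Z slack))
    (ν3≥half-* h (ν3≥half-m (4 * i + c) (i + k)))
  where
  Z = 12 * i + 2 * B + 9 * k + 10
  left : ∀ c inc i k B d → 3 * c + 2 * inc + 2 + 2 * d + (12 * i + 2 * B + 9 * k + 10)
                            ≡ 2 * (inc + B) + 9 * k + 2 * d + (10 + (3 * (4 * i + c) + 1) + 1)
  left = solve-∀
  right : ∀ i k B e → 6 * i + 2 * e + (12 * i + 2 * B + 9 * k + 10)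
                      ≡ 2 * B + 9 * i + 2 * e + 9 * (i + k) + 10
  right = solve-∀

12≤6*[2+i] : ∀ i → 12 ≤ 6 * (2 + i)
12≤6*[2+i] i = *-monoʳ-≤ 6 (m≤m+n 2 i)

ν3≥half-summand-odd : ∀ B {p} i k → ν3≥half p (2 * B + 9 * suc i + 2 * δ1 (suc i)) 10 →
  ν3≥half (p * m (4 * suc i + 0) (suc i + k)) (2 * (2 + B) + 9 * k + 2 * δ1 k) 10
ν3≥half-summand-odd B zero    k =
  ν3≥half-summand {B = B} 0 2 1 k (+-monoʳ-≤ 6 (*-monoʳ-≤ 2 (δ1≤1 k)))
ν3≥half-summand-odd B (suc i) k = ν3≥half-summand {B = B} 0 2 (2 + i) k
  (≤-trans (+-monoʳ-≤ 6 (*-monoʳ-≤ 2 (δ1≤1 k))) (≤-trans (m≤m+n 8 4) (m≤n⇒m≤n+o 0 (12≤6*[2+i] i))))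

ν3≥half-summand-even : ∀ B {p} i k → ν3≥half p (2 * B + 9 * suc i + 2 * δ1 (suc i)) 10 →
  ν3≥half (p * m (4 * suc i + 2) (suc i + k)) (2 * (0 + B) + 9 * k + 2 * δ1 k) 10
ν3≥half-summand-even B zero zero          = ν3≥half-summand {B = B} 2 0 1 0 ≤-refl
-- m(6,2) = 1, so the bound on a(n,1) has to carry the summand on its own
ν3≥half-summand-even B zero 1             = ν3≥half-*ʳ _
ν3≥half-summand-even B zero (suc (suc k)) = ν3≥half-summand {B = B} 2 0 1 (2 + k) ≤-refl
ν3≥half-summand-even B (suc i) k = ν3≥half-summand {B = B} 2 0 (2 + i) k
  (≤-trans (+-monoʳ-≤ 8 (*-monoʳ-≤ 2 (δ1≤1 k))) (≤-trans (m≤m+n 10 2) (m≤n⇒m≤n+o 0 (12≤6*[2+i] i))))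

offset : ℕ → ℕ
offset n = if (n % 2) ≡ᵇ 1 then 0 else 2

offset-odd : ∀ t → offset (1 + t * 2) ≡ 0
offset-odd t = cong (λ r → if r ≡ᵇ 1 then 0 else 2) ([m+kn]%n≡m%n 1 t 2)

offset-even : ∀ t → offset (2 + t * 2) ≡ 2
offset-even t = cong (λ r → if r ≡ᵇ 1 then 0 else 2) ([m+kn]%n≡m%n 2 t 2)

ABound-step : ∀ {j B B′} c → offset (suc j) ≡ c →
  (∀ {p} i k → ν3≥half p (2 * B + 9 * suc i + 2 * δ1 (suc i)) 10 →
     ν3≥half (p * m (4 * suc i + c) (suc i + k)) (2 * B′ + 9 * k + 2 * δ1 k) 10) →
  ABound (suc j) B → ABound (suc (suc j)) B′
ABound-step c refl term (aBound IH) =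
  aBound λ k → ν3≥half-sum1 (λ i → term i k (IH (suc i))) (3 * k)

ABound-rows : ∀ t → ABound (1 + t * 2) (1 + t * 2) × ABound (2 + t * 2) (3 + t * 2)
ABound-rows zero    = ABound-1 , ABound-step 0 (offset-odd 0) (ν3≥half-summand-odd 1) ABound-1
ABound-rows (suc t) = odd , ABound-step 0 (offset-odd (suc t)) (ν3≥half-summand-odd (3 + t * 2)) odd
  where
  odd : ABound (3 + t * 2) (3 + t * 2)
  odd = ABound-step 2 (offset-even t) (ν3≥half-summand-even (3 + t * 2)) (proj₂ (ABound-rows t))

double-≤-floorHalf : ∀ {e} b c w → + e ℤ.≤ + b ℤ.+ (+ c ℤ.- + w) /ℕ 2 →
                     2 * e + w ≤ 2 * b + c
double-≤-floorHalf {e} b c w le = ℤ.drop‿+≤+ (begin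
  + (2 * e + w)                       ≡⟨ ℤ.pos-+ (2 * e) w ⟩
  + (2 * e) ℤ.+ + w                   ≡⟨ cong (ℤ._+ + w) (ℤ.pos-* 2 e) ⟩
  + 2 ℤ.* + e ℤ.+ + w                 ≤⟨ ℤ.+-monoˡ-≤ (+ w) (ℤ.*-monoˡ-≤-nonNeg (+ 2) le) ⟩
  + 2 ℤ.* (+ b ℤ.+ q) ℤ.+ + w         ≡⟨ regroup (+ b) q (+ w) ⟩
  + 2 ℤ.* + b ℤ.+ q ℤ.* + 2 ℤ.+ + w   ≤⟨ ℤ.+-monoˡ-≤ (+ w) (ℤ.+-monoʳ-≤ (+ 2 ℤ.* + b) ([n/ℕd]*d≤n z 2)) ⟩
  + 2 ℤ.* + b ℤ.+ z ℤ.+ + w           ≡⟨ cancel (+ b) (+ c) (+ w) ⟩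
  + 2 ℤ.* + b ℤ.+ + c                 ≡⟨ cong (ℤ._+ + c) (ℤ.pos-* 2 b) ⟨
  + (2 * b) ℤ.+ + c                   ≡⟨ ℤ.pos-+ (2 * b) c ⟨
  + (2 * b + c)                       ∎)
  where
  open ℤ.≤-Reasoning
  z = + c ℤ.- + w
  q = z /ℕ 2
  regroup : ∀ b q w → + 2 ℤ.* (b ℤ.+ q) ℤ.+ w ≡ + 2 ℤ.* b ℤ.+ q ℤ.* + 2 ℤ.+ w
  regroup = ℤ-Solver.solve-∀
  cancel : ∀ b c w → + 2 ℤ.* b ℤ.+ (c ℤ.- w) ℤ.+ w ≡ + 2 ℤ.* b ℤ.+ c
  cancel = ℤ-Solver.solve-∀

ν3≥half⇒ν3≥ : ∀ {n v u} b c w → 2 * b + u + c ≡ v + w → ν3≥half n v u →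
              ν3≥ n (+ b ℤ.+ (+ c ℤ.- + w) /ℕ 2)
ν3≥half⇒ν3≥ {v = v} {u} b c w eq h e le = h e (+-cancelʳ-≤ w _ _ (begin
  2 * e + u + w ≡⟨ swap (2 * e) u w ⟩
  2 * e + w + u ≤⟨ +-monoˡ-≤ u (double-≤-floorHalf b c w le) ⟩
  2 * b + c + u ≡⟨ swap (2 * b) c u ⟩
  2 * b + u + c ≡⟨ eq ⟩
  v + w         ∎))
  where
  open ≤-Reasoning
  swap : ∀ a b c → a + b + c ≡ a + c + b
  swap = solve-∀

ABound⇒ν3≥ : ∀ {n B} → ABound n B → ∀ k → ν3≥ (a n k) (+ B ℤ.+ + δ1 k ℤ.+ fl k)
ABound⇒ν3≥ {B = B} (aBound h) k = ν3≥half⇒ν3≥ (B + δ1 k) (9 * k) 10 (regroup B k (δ1 k)) (h k)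
  where
  regroup : ∀ B k d → 2 * (B + d) + 10 + 9 * k ≡ 2 * B + 9 * k + 2 * d + 10
  regroup = solve-∀

lemma3p4 : (j k : ℕ) → 1 ≤ j → 1 ≤ k →
    ν3≥ (a (2 * j ∸ 1) k) (+ (2 * j ∸ 1) ℤ.+ + δ1 k ℤ.+ fl k)
      × ν3≥ (a (2 * j) k) (+ (2 * j + 1) ℤ.+ + δ1 k ℤ.+ fl k)
lemma3p4 (suc t) k _ _ = ABound⇒ν3≥ odd k , ABound⇒ν3≥ even k
  where
  2j≡ : 2 * suc t ≡ 2 + t * 2
  2j≡ = *-comm 2 (suc t)
  odd : ABound (2 * suc t ∸ 1) (2 * suc t ∸ 1)
  odd = subst (λ n → ABound n n) (cong (_∸ 1) (sym 2j≡)) (proj₁ (ABound-rows t))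
  even : ABound (2 * suc t) (2 * suc t + 1)
  even = subst₂ ABound (sym 2j≡) (trans (+-comm 1 (2 + t * 2)) (cong (_+ 1) (sym 2j≡)))
                (proj₂ (ABound-rows t))
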